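{- Let $G=(V,E)$ be a simple undirected graph with nonnegative edge costs $\mathit{cost}\in\mathbb{R}_+^{E}$, and let $T$ be a spanning tree of $G$ all of whose edges have cost $0$. Let $L(G)=E(G)\setminus E(T)$ be the set of links. Then every extreme point $x$ of the polyhedron \[ \Big\{x\in\mathbb{R}^{L(G)} : \sum_{\ell\in L(G)\cap e_{G-u}(\mathcal{P})} x_\ell \ge |\mathcal{P}|-1 \ \ \forall u\in \mathrm{nonleaf}(T),\ \forall \mathcal{P}\in \Pi(u);\quad x_\ell\ge 0\ \ \forall \ell\in L(G)\Big\} \] satisfies $x\in[0,1]^{L(G)}$.
   Context: $\mathrm{nonleaf}(T)$ is the set of non-leaf nodes of $T$. For $u\in\mathrm{nonleaf}(T)$, $\pi(\mathrm{comps}(T-u))$ denotes the partition of $V\setminus\{u\}$ whose parts are the node sets of the connected components of $T-u$, and $\Pi(u)$ denotes the set of all partitions $\mathcal{P}$ of $V\setminus\{u\}$ such that $\pi(\mathrm{comps}(T-u))$ is a refinement of $\mathcal{P}$ (i.e., partitions obtained by merging some parts of $\pi(\mathrm{comps}(T-u))$). For a graph $H$ and a partition $\mathcal{P}$ of $V(H)$, $e_H(\mathcal{P})$ is the set of edges of $H$ whose two end nodes lie in different parts of $\mathcal{P}$; $|\mathcal{P}|$ is the number of parts.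
   Formalization: The edge costs are rational, and the polyhedron and its extreme points are taken over the rationals rather than the reals. -}

module Defs where

open import Data.Bool using (Bool; true; false; _∧_; not; if_then_else_)
open import Data.Nat as ℕ using (ℕ; suc; _<ᵇ_)
open import Data.Fin using (Fin; toℕ; _≟_)
open import Data.Fin.Properties using () renaming (_≟_ to _≟F_)
open import Data.List using (List; []; _∷_; [_]; _++_; length; map; filterᵇ; concatMap; allFin; foldr)
open import Data.Bool.ListAction using (any)
open import Data.List.Relation.Unary.Linked using (Linked)
open import Data.List.Relation.Unary.Unique.Propositional using (Unique)
open import Data.Product using (_×_; _,_)
open import Data.Rational as ℚ using (ℚ; 0ℚ; 1ℚ; _+_; _*_; _-_; _/_)
open import Data.Integer using (+_)
open import Relation.Binary.PropositionalEquality using (_≡_; _≢_)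
open import Relation.Binary.Construct.Closure.ReflexiveTransitive using (Star)
open import Relation.Nullary.Decidable using (⌊_⌋)

-- Simple graphs on the vertex set V = Fin n, given by a Boolean adjacency
-- function.  An (undirected) edge {i,j} is represented by the ordered pair
-- (i , j) with toℕ i < toℕ j.
Adj : ℕ → Set
Adj n = Fin n → Fin n → Bool

IsSimpleGraph : ∀ {n} → Adj n → Set
IsSimpleGraph {n} g = (∀ (i j : Fin n) → g i j ≡ g j i) × (∀ (i : Fin n) → g i i ≡ false)

_─[_]─_ : ∀ {n} → Fin n → Adj n → Fin n → Set
i ─[ g ]─ j = g i j ≡ true

IsConnected : ∀ {n} → Adj n → Set
IsConnected {n} g = ∀ (v w : Fin n) → Star (λ a b → a ─[ g ]─ b) v w

IsCycle : ∀ {n} → Adj n → List (Fin n) → Set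
IsCycle g [] = Data.Empty.⊥ where import Data.Empty
IsCycle g (v ∷ ws) =
  (2 ℕ.≤ length ws) × Unique (v ∷ ws) × Linked (λ a b → a ─[ g ]─ b) (v ∷ ws ++ [ v ])

IsAcyclic : ∀ {n} → Adj n → Set
IsAcyclic {n} g = ∀ (c : List (Fin n)) → IsCycle g c → Data.Empty.⊥ where import Data.Empty

IsTree : ∀ {n} → Adj n → Set
IsTree g = IsConnected g × IsAcyclic g

IsSpanningTree : ∀ {n} → Adj n → Adj n → Set
IsSpanningTree {n} g t =
  (∀ (i j : Fin n) → t i j ≡ t j i) × (∀ (i j : Fin n) → i ─[ t ]─ j → i ─[ g ]─ j) × IsTree t

allPairs : ∀ n → List (Fin n × Fin n)
allPairs n = concatMap (λ i → map (λ j → (i , j)) (allFin n)) (allFin n)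

isEdgeB : ∀ {n} → Adj n → Fin n → Fin n → Bool
isEdgeB g i j = (toℕ i <ᵇ toℕ j) ∧ g i j

isLinkB : ∀ {n} → Adj n → Adj n → Fin n → Fin n → Bool
isLinkB g t i j = isEdgeB g i j ∧ not (t i j)

IsLink : ∀ {n} → Adj n → Adj n → Fin n → Fin n → Set
IsLink g t i j = isLinkB g t i j ≡ true

degree : ∀ {n} → Adj n → Fin n → ℕ
degree {n} t u = length (filterᵇ (λ j → t u j) (allFin n))

IsNonLeaf : ∀ {n} → Adj n → Fin n → Set
IsNonLeaf t u = 2 ℕ.≤ degree t u

-- A partition of V \ {u} is represented by a labelling p : Fin n → Fin n
-- (values at u are ignored); parts are the nonempty fibres p⁻¹(k) ∩ (V\{u}).

-- p ∈ Π(u): vertices in the same component of T - u get the same label,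
-- i.e. π(comps(T-u)) refines the partition given by p.
InΠ : ∀ {n} → Adj n → Fin n → (Fin n → Fin n) → Set
InΠ {n} t u p = ∀ (v w : Fin n) → v ≢ u → w ≢ u →
  Star (λ a b → a ≢ u × b ≢ u × a ─[ t ]─ b) v w → p v ≡ p w

numParts : ∀ {n} → Fin n → (Fin n → Fin n) → ℕ
numParts {n} u p = length (filterᵇ
  (λ k → any (λ v → not ⌊ v ≟F u ⌋ ∧ ⌊ p v ≟F k ⌋) (allFin n))
  (allFin n))

crossesB : ∀ {n} → Fin n → (Fin n → Fin n) → Fin n → Fin n → Bool
crossesB u p i j = not ⌊ i ≟F u ⌋ ∧ not ⌊ j ≟F u ⌋ ∧ not ⌊ p i ≟F p j ⌋

sumℚ : List ℚ → ℚ
sumℚ = foldr _+_ 0ℚ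

-- Vectors x ∈ ℚ^{L(G)} are represented by functions Fin n → Fin n → ℚ, only
-- the values x i j at links (i , j) being relevant.
-- ∑_{ℓ ∈ L(G) ∩ e_{G-u}(P)} x_ℓ
cutSum : ∀ {n} → Adj n → Adj n → Fin n → (Fin n → Fin n) → (Fin n → Fin n → ℚ) → ℚ
cutSum {n} g t u p x = sumℚ (map
  (λ ij → if isLinkB g t (Data.Product.proj₁ ij) (Data.Product.proj₂ ij)
               ∧ crossesB u p (Data.Product.proj₁ ij) (Data.Product.proj₂ ij)
          then x (Data.Product.proj₁ ij) (Data.Product.proj₂ ij) else 0ℚ)
  (allPairs n))
  where import Data.Product

ℕtoℚ : ℕ → ℚ
ℕtoℚ m = (+ m) / 1

InPoly : ∀ {n} → Adj n → Adj n → (Fin n → Fin n → ℚ) → Set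
InPoly {n} g t x =
  (∀ (u : Fin n) → IsNonLeaf t u → ∀ (p : Fin n → Fin n) → InΠ t u p →
      ℕtoℚ (numParts u p) - 1ℚ ℚ.≤ cutSum g t u p x)
  × (∀ (i j : Fin n) → IsLink g t i j → 0ℚ ℚ.≤ x i j)

EqOnLinks : ∀ {n} → Adj n → Adj n → (Fin n → Fin n → ℚ) → (Fin n → Fin n → ℚ) → Set
EqOnLinks {n} g t x y = ∀ (i j : Fin n) → IsLink g t i j → x i j ≡ y i j

IsExtremePoint : ∀ {n} → Adj n → Adj n → (Fin n → Fin n → ℚ) → Set
IsExtremePoint {n} g t x = InPoly g t x ×
  (∀ (y z : Fin n → Fin n → ℚ) (λ′ : ℚ) → InPoly g t y → InPoly g t z →
     0ℚ ℚ.< λ′ → λ′ ℚ.< 1ℚ →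
     EqOnLinks g t x (λ i j → λ′ * y i j + (1ℚ - λ′) * z i j) →
     EqOnLinks g t y z)

-- Suppose a link ℓ had x ℓ > 1.  Then x is the midpoint of y and z, obtained
-- from x by setting the ℓ-coordinate to 1 and to 2 x ℓ − 1 respectively.  Both
-- are feasible, because raising one link coordinate to any value c ≥ 1 keeps
-- every cut constraint: if ℓ crosses 𝒫, merging the two parts of 𝒫 met by ℓ
-- gives 𝒫′ ∈ Π(u) with at most one part fewer, whose cut misses only ℓ among the cut
-- links of 𝒫, and ℓ now contributes c ≥ 1.  As y ≠ z on ℓ, x is not extreme.
-- Neither the tree structure of T nor the costs play a role.

module Submission where

open import Defs
open import Data.Nat using (ℕ)
open import Data.Fin using (Fin)
open import Data.Product using (_×_)
open import Data.Rational using (ℚ; 0ℚ; 1ℚ; _≤_)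
open import Relation.Binary.PropositionalEquality using (_≡_)

open import Data.Bool using (Bool; true; false; _∧_; not; if_then_else_)
open import Data.Bool.ListAction using (any)
open import Data.Empty using (⊥-elim)
open import Data.Fin.Properties using (_≟_)
open import Data.Integer as ℤ using (+_)
import Data.Integer.Properties as ℤP
open import Data.List using (List; []; _∷_; length; map; filterᵇ; allFin)
open import Data.List.Membership.Propositional using (_∈_)
open import Data.List.Membership.Propositional.Properties using (∈-concatMap⁺; ∈-map⁺; ∈-allFin)
open import Data.List.Relation.Unary.All using (All; []; _∷_)
import Data.List.Relation.Unary.All as All
open import Data.List.Relation.Unary.AllPairs using ([]; _∷_)
open import Data.List.Relation.Unary.Any as Any using (here; there)
open import Data.List.Relation.Unary.Unique.Propositional using (Unique)
open import Data.List.Relation.Unary.Unique.Propositional.Properties using (allFin⁺)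
import Data.Nat as ℕ
import Data.Nat.Properties as ℕP
open import Data.Nat.Coprimality using (1-coprimeTo) renaming (sym to coprime-sym)
open import Data.Product using (_,_; proj₁; proj₂)
open import Data.Product.Properties using (≡-dec)
open import Data.Rational as ℚ using (mkℚ; *≤*; _+_; _-_; _*_; ½; _<_)
import Data.Rational.Properties as ℚP
open import Data.Rational.Solver using (module +-*-Solver)
open import Data.Sum using (_⊎_; inj₁; inj₂)
open import Relation.Binary.PropositionalEquality using (refl; sym; trans; cong; cong₂; subst; _≢_; module ≡-Reasoning)
open import Relation.Nullary using (Dec; yes; no; ¬_)
open import Relation.Nullary.Decidable using (⌊_⌋; toWitness; toSum)

open +-*-Solver

ℕtoℚ≡mkℚ : ∀ m → ℕtoℚ m ≡ mkℚ (+ m) 0 (coprime-sym (1-coprimeTo m))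
ℕtoℚ≡mkℚ m = ℚP.normalize-coprime (coprime-sym (1-coprimeTo m))

ℕtoℚ-mono : ∀ {m m′} → m ℕ.≤ m′ → ℕtoℚ m ≤ ℕtoℚ m′
ℕtoℚ-mono {m} {m′} m≤m′ rewrite ℕtoℚ≡mkℚ m | ℕtoℚ≡mkℚ m′ =
  *≤* (ℤP.*-monoʳ-≤-nonNeg (+ 1) (ℤ.+≤+ m≤m′))

ℕtoℚ-suc : ∀ m → ℕtoℚ (ℕ.suc m) ≡ ℕtoℚ m + 1ℚ
ℕtoℚ-suc m = begin
  ℕtoℚ (ℕ.suc m)                                  ≡⟨ ℚP./-cong (sym numerator) refl ⟩
  (+ m ℤ.* + 1 ℤ.+ + 1) ℚ./ 1                     ≡⟨⟩
  mkℚ (+ m) 0 (coprime-sym (1-coprimeTo m)) + 1ℚ  ≡⟨ cong (_+ 1ℚ) (ℕtoℚ≡mkℚ m) ⟨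
  ℕtoℚ m + 1ℚ                                     ∎
  where
  open ≡-Reasoning
  numerator : + m ℤ.* + 1 ℤ.+ + 1 ≡ + ℕ.suc m
  numerator = trans (cong (ℤ._+ + 1) (ℤP.*-identityʳ (+ m))) (cong +_ (ℕP.+-comm m 1))

p-1+1≡p : ∀ a → (a - 1ℚ) + 1ℚ ≡ a
p-1+1≡p = solve 1 (λ a → (a :- con 1ℚ) :+ con 1ℚ := a) refl

m≤1+n⇒ℕtoℚ[m]-1≤ℕtoℚ[n] : ∀ {m n} → m ℕ.≤ ℕ.suc n → ℕtoℚ m - 1ℚ ≤ ℕtoℚ n
m≤1+n⇒ℕtoℚ[m]-1≤ℕtoℚ[n] {m} {n} m≤1+n = begin
  ℕtoℚ m - 1ℚ                ≤⟨ ℚP.+-monoˡ-≤ (ℚ.- 1ℚ) (ℕtoℚ-mono m≤1+n) ⟩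
  ℕtoℚ (ℕ.suc n) - 1ℚ        ≡⟨ cong (_- 1ℚ) (ℕtoℚ-suc n) ⟩
  (ℕtoℚ n + 1ℚ) - 1ℚ         ≡⟨ solve 1 (λ a → (a :+ con 1ℚ) :- con 1ℚ := a) refl (ℕtoℚ n) ⟩
  ℕtoℚ n                     ∎
  where open ℚP.≤-Reasoning

sumℚ-mono : ∀ {A : Set} {f h : A → ℚ} → (∀ a → f a ≤ h a) →
            ∀ l → sumℚ (map f l) ≤ sumℚ (map h l)
sumℚ-mono f≤h []      = ℚP.≤-refl
sumℚ-mono f≤h (a ∷ l) = ℚP.+-mono-≤ (f≤h a) (sumℚ-mono f≤h l)

sumℚ-cong : ∀ {A : Set} {f h : A → ℚ} → (∀ a → f a ≡ h a) →
            ∀ l → sumℚ (map f l) ≡ sumℚ (map h l)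
sumℚ-cong f≡h []      = refl
sumℚ-cong f≡h (a ∷ l) = cong₂ _+_ (f≡h a) (sumℚ-cong f≡h l)

sumℚ-mono-+1 : ∀ {A : Set} {f h : A → ℚ} {a₀ : A} → (∀ a → f a ≤ h a) →
               f a₀ + 1ℚ ≤ h a₀ → ∀ {l} → a₀ ∈ l → sumℚ (map f l) + 1ℚ ≤ sumℚ (map h l)
sumℚ-mono-+1 {f = f} {h} f≤h gain {a ∷ l} (here refl) = begin
  (f a + sumℚ (map f l)) + 1ℚ   ≡⟨ swap (f a) (sumℚ (map f l)) ⟩
  (f a + 1ℚ) + sumℚ (map f l)   ≤⟨ ℚP.+-mono-≤ gain (sumℚ-mono f≤h l) ⟩
  h a + sumℚ (map h l)          ∎
  where
  open ℚP.≤-Reasoning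
  swap : ∀ p q → (p + q) + 1ℚ ≡ (p + 1ℚ) + q
  swap = solve 2 (λ p q → (p :+ q) :+ con 1ℚ := (p :+ con 1ℚ) :+ q) refl
sumℚ-mono-+1 {f = f} {h} f≤h gain {a ∷ l} (there a₀∈l) = begin
  (f a + sumℚ (map f l)) + 1ℚ   ≡⟨ ℚP.+-assoc (f a) (sumℚ (map f l)) 1ℚ ⟩
  f a + (sumℚ (map f l) + 1ℚ)   ≤⟨ ℚP.+-mono-≤ (f≤h a) (sumℚ-mono-+1 f≤h gain a₀∈l) ⟩
  h a + sumℚ (map h l)          ∎
  where open ℚP.≤-Reasoning

∈-allPairs : ∀ {n} (a b : Fin n) → (a , b) ∈ allPairs n
∈-allPairs a b = ∈-concatMap⁺ _ (Any.map (λ { refl → ∈-map⁺ _ (∈-allFin b) }) (∈-allFin a))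

length-filterᵇ-mono : ∀ {A : Set} {P Q : A → Bool} {l : List A} →
  All (λ a → P a ≡ true → Q a ≡ true) l → length (filterᵇ P l) ℕ.≤ length (filterᵇ Q l)
length-filterᵇ-mono [] = ℕ.z≤n
length-filterᵇ-mono {P = P} {Q} {a ∷ l} (P⇒Q ∷ rest) with P a | Q a
... | true  | true  = ℕ.s≤s (length-filterᵇ-mono rest)
... | true  | false with () ← P⇒Q refl
... | false | true  = ℕP.m≤n⇒m≤1+n (length-filterᵇ-mono rest)
... | false | false = length-filterᵇ-mono rest

length-filterᵇ-≤-suc : ∀ {A : Set} {P Q : A → Bool} (k₀ : A) {l : List A} → Unique l →
  (∀ a → P a ≡ true → Q a ≡ true ⊎ a ≡ k₀) →
  length (filterᵇ P l) ℕ.≤ ℕ.suc (length (filterᵇ Q l))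
length-filterᵇ-≤-suc k₀ {[]} [] P⇒Q = ℕ.z≤n
length-filterᵇ-≤-suc {P = P} {Q} k₀ {a ∷ l} (a∉l ∷ uniq) P⇒Q with P a in Pa | Q a in Qa
... | false | false = length-filterᵇ-≤-suc k₀ uniq P⇒Q
... | false | true  = ℕP.m≤n⇒m≤1+n (length-filterᵇ-≤-suc k₀ uniq P⇒Q)
... | true  | true  = ℕ.s≤s (length-filterᵇ-≤-suc k₀ uniq P⇒Q)
... | true  | false with P⇒Q a Pa
...   | inj₁ Qa′ with () ← trans (sym Qa) Qa′
...   | inj₂ refl = ℕ.s≤s (length-filterᵇ-mono (All.map P⇒Q-off a∉l))
  where
  P⇒Q-off : ∀ {b} → a ≢ b → P b ≡ true → Q b ≡ true
  P⇒Q-off {b} a≢b Pb with P⇒Q b Pb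
  ... | inj₁ Qb  = Qb
  ... | inj₂ b≡a = ⊥-elim (a≢b (sym b≡a))

module _ {n : ℕ} where

  mergeParts : Fin n → Fin n → (Fin n → Fin n) → Fin n → Fin n
  mergeParts i j p v = if ⌊ p v ≟ p j ⌋ then p i else p v

  mergeParts-resp : ∀ i j p {a b} → p a ≡ p b → mergeParts i j p a ≡ mergeParts i j p b
  mergeParts-resp i j p p[a]≡p[b] = cong (λ k → if ⌊ k ≟ p j ⌋ then p i else k) p[a]≡p[b]

  mergeParts-joins : ∀ i j p → mergeParts i j p i ≡ mergeParts i j p j
  mergeParts-joins i j p with p i ≟ p j | p j ≟ p j
  ... | _     | no p[j]≢p[j] = ⊥-elim (p[j]≢p[j] refl)
  ... | yes _ | yes _        = refl
  ... | no _  | yes _        = refl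

  mergeParts-other : ∀ i j p {v} → p v ≢ p j → mergeParts i j p v ≡ p v
  mergeParts-other i j p {v} p[v]≢p[j] with p v ≟ p j
  ... | yes p[v]≡p[j] = ⊥-elim (p[v]≢p[j] p[v]≡p[j])
  ... | no _          = refl

  mergeParts-InΠ : ∀ {t : Adj n} {u} i j {p} → InΠ t u p → InΠ t u (mergeParts i j p)
  mergeParts-InΠ i j {p} p∈Π v w v≢u w≢u path = mergeParts-resp i j p (p∈Π v w v≢u w≢u path)

  isPartB : Fin n → (Fin n → Fin n) → Fin n → Bool
  isPartB u p k = any (λ v → not ⌊ v ≟ u ⌋ ∧ ⌊ p v ≟ k ⌋) (allFin n)

  any-mono : ∀ {A : Set} {f h : A → Bool} → (∀ a → f a ≡ true → h a ≡ true) →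
             ∀ l → any f l ≡ true → any h l ≡ true
  any-mono {f = f} {h} f⇒h (a ∷ l) any-f with f a in fa | h a in ha
  ... | true  | true  = refl
  ... | true  | false with () ← trans (sym ha) (f⇒h a fa)
  ... | false | true  = refl
  ... | false | false = any-mono f⇒h l any-f

  isPartB-mergeParts : ∀ u i j p k → isPartB u p k ≡ true →
                       isPartB u (mergeParts i j p) k ≡ true ⊎ k ≡ p j
  isPartB-mergeParts u i j p k k∈p with k ≟ p j
  ... | yes k≡p[j] = inj₂ k≡p[j]
  ... | no  k≢p[j] = inj₁ (any-mono keeps-label (allFin n) k∈p)
    where
    keeps-label : ∀ v → (not ⌊ v ≟ u ⌋ ∧ ⌊ p v ≟ k ⌋) ≡ true →
                  (not ⌊ v ≟ u ⌋ ∧ ⌊ mergeParts i j p v ≟ k ⌋) ≡ true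
    keeps-label v h with v ≟ u | p v ≟ k
    ... | no _ | yes refl with mergeParts i j p v ≟ p v
    ...   | yes _              = refl
    ...   | no merged≢p[v] = ⊥-elim (merged≢p[v] (mergeParts-other i j p k≢p[j]))

  numParts-mergeParts : ∀ u i j p → numParts u p ℕ.≤ ℕ.suc (numParts u (mergeParts i j p))
  numParts-mergeParts u i j p = length-filterᵇ-≤-suc (p j) (allFin⁺ n) (isPartB-mergeParts u i j p)

module _ {n : ℕ} where

  _≟²_ : (ab cd : Fin n × Fin n) → Dec (ab ≡ cd)
  _≟²_ = ≡-dec _≟_ _≟_

  update : (Fin n → Fin n → ℚ) → Fin n → Fin n → ℚ → Fin n → Fin n → ℚ
  update x i j c a b = if ⌊ (a , b) ≟² (i , j) ⌋ then c else x a b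

  update-same : ∀ x i j c → update x i j c i j ≡ c
  update-same x i j c with (i , j) ≟² (i , j)
  ... | yes _   = refl
  ... | no ij≢ij = ⊥-elim (ij≢ij refl)

  update-other : ∀ x i j c {a b} → (a , b) ≢ (i , j) → update x i j c a b ≡ x a b
  update-other x i j c {a} {b} ab≢ij with (a , b) ≟² (i , j)
  ... | yes ab≡ij = ⊥-elim (ab≢ij ab≡ij)
  ... | no _      = refl

crossesB-coarsen : ∀ {n} u {p q : Fin n → Fin n} a b → (p a ≡ p b → q a ≡ q b) →
                   crossesB u q a b ≡ true → crossesB u p a b ≡ true
crossesB-coarsen u {p} {q} a b p⇒q q-crosses with a ≟ u | b ≟ u | q a ≟ q b | p a ≟ p b
... | no _ | no _ | no _      | no _      = refl
... | no _ | no _ | no q[a]≢q[b] | yes p[a]≡p[b] = ⊥-elim (q[a]≢q[b] (p⇒q p[a]≡p[b]))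

crossesB-same-part : ∀ {n} u (q : Fin n → Fin n) a b → q a ≡ q b → crossesB u q a b ≡ false
crossesB-same-part u q a b q[a]≡q[b] with a ≟ u | b ≟ u | q a ≟ q b
... | yes _ | _     | _     = refl
... | no _  | yes _ | _     = refl
... | no _  | no _  | yes _ = refl
... | no _  | no _  | no q[a]≢q[b] = ⊥-elim (q[a]≢q[b] q[a]≡q[b])

module _ {n : ℕ} (g t : Adj n) where

  NonNegOnLinks : (Fin n → Fin n → ℚ) → Set
  NonNegOnLinks x = ∀ a b → IsLink g t a b → 0ℚ ≤ x a b

  cutTerm : Fin n → (Fin n → Fin n) → (Fin n → Fin n → ℚ) → Fin n × Fin n → ℚ
  cutTerm u p x (a , b) = if isLinkB g t a b ∧ crossesB u p a b then x a b else 0ℚ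

  cutTerm-nonneg : ∀ {x} → NonNegOnLinks x → ∀ u p ab → 0ℚ ≤ cutTerm u p x ab
  cutTerm-nonneg {x} x≥0 u p (a , b) with isLinkB g t a b in link | crossesB u p a b
  ... | true  | true  = x≥0 a b link
  ... | true  | false = ℚP.≤-refl
  ... | false | _     = ℚP.≤-refl

  cutTerm-uncrossed : ∀ u p x a b → crossesB u p a b ≡ false → cutTerm u p x (a , b) ≡ 0ℚ
  cutTerm-uncrossed u p x a b uncrossed rewrite uncrossed with isLinkB g t a b
  ... | true  = refl
  ... | false = refl

  cutTerm-crossed : ∀ u p x a b → IsLink g t a b → crossesB u p a b ≡ true →
                    cutTerm u p x (a , b) ≡ x a b
  cutTerm-crossed u p x a b ab-link crossed rewrite ab-link | crossed = refl

  cutTerm-cong : ∀ u p x y a b → x a b ≡ y a b → cutTerm u p x (a , b) ≡ cutTerm u p y (a , b)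
  cutTerm-cong u p x y a b x≡y = cong (λ v → if isLinkB g t a b ∧ crossesB u p a b then v else 0ℚ) x≡y

  cutTerm-coarsen : ∀ {x} → NonNegOnLinks x → ∀ u {p q} a b → (p a ≡ p b → q a ≡ q b) →
                    cutTerm u q x (a , b) ≤ cutTerm u p x (a , b)
  cutTerm-coarsen {x} x≥0 u {p} {q} a b p⇒q
    with isLinkB g t a b in link | crossesB u q a b in q-crosses | crossesB u p a b in p-crosses
  ... | false | _     | _     = ℚP.≤-refl
  ... | true  | false | false = ℚP.≤-refl
  ... | true  | false | true  = x≥0 a b link
  ... | true  | true  | true  = ℚP.≤-refl
  ... | true  | true  | false
    with () ← trans (sym p-crosses) (crossesB-coarsen u a b p⇒q q-crosses)

module _ {n : ℕ} {g t : Adj n} {x : Fin n → Fin n → ℚ} (x∈P : InPoly g t x)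
         {i j : Fin n} (ij-link : IsLink g t i j) {c : ℚ} (1≤c : 1ℚ ≤ c) where

  private
    y : Fin n → Fin n → ℚ
    y = update x i j c

    x≥0 : NonNegOnLinks g t x
    x≥0 = proj₂ x∈P

    0≤c : 0ℚ ≤ c
    0≤c = ℚP.≤-trans (toWitness {a? = 0ℚ ℚP.≤? 1ℚ} _) 1≤c

  update-nonneg : NonNegOnLinks g t y
  update-nonneg a b ab-link with toSum ((a , b) ≟² (i , j))
  ... | inj₁ refl  = subst (0ℚ ≤_) (sym (update-same x i j c)) 0≤c
  ... | inj₂ ab≢ij = subst (0ℚ ≤_) (sym (update-other x i j c ab≢ij)) (x≥0 a b ab-link)

  cutSum-update-uncrossed : ∀ u p → crossesB u p i j ≡ false → cutSum g t u p y ≡ cutSum g t u p x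
  cutSum-update-uncrossed u p uncrossed = sumℚ-cong same-term (allPairs n)
    where
    same-term : ∀ ab → cutTerm g t u p y ab ≡ cutTerm g t u p x ab
    same-term (a , b) with toSum ((a , b) ≟² (i , j))
    ... | inj₁ refl  = trans (cutTerm-uncrossed g t u p y i j uncrossed)
                           (sym (cutTerm-uncrossed g t u p x i j uncrossed))
    ... | inj₂ ab≢ij = cutTerm-cong g t u p y x a b (update-other x i j c ab≢ij)

  cutSum-update-crossed : ∀ u p → crossesB u p i j ≡ true →
                          cutSum g t u (mergeParts i j p) x + 1ℚ ≤ cutSum g t u p y
  cutSum-update-crossed u p crossed = sumℚ-mono-+1 term-≤ gain (∈-allPairs i j)
    where
    p′ : Fin n → Fin n
    p′ = mergeParts i j p

    ij-uncrossed : crossesB u p′ i j ≡ false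
    ij-uncrossed = crossesB-same-part u p′ i j (mergeParts-joins i j p)

    term-≤ : ∀ ab → cutTerm g t u p′ x ab ≤ cutTerm g t u p y ab
    term-≤ (a , b) with toSum ((a , b) ≟² (i , j))
    ... | inj₁ refl  = subst (_≤ cutTerm g t u p y (i , j))
                           (sym (cutTerm-uncrossed g t u p′ x i j ij-uncrossed))
                           (cutTerm-nonneg g t update-nonneg u p (i , j))
    ... | inj₂ ab≢ij = ℚP.≤-trans (cutTerm-coarsen g t x≥0 u a b (mergeParts-resp i j p))
                         (ℚP.≤-reflexive (cutTerm-cong g t u p x y a b (sym (update-other x i j c ab≢ij))))

    gain : cutTerm g t u p′ x (i , j) + 1ℚ ≤ cutTerm g t u p y (i , j)
    gain = begin
      cutTerm g t u p′ x (i , j) + 1ℚ  ≡⟨ cong (_+ 1ℚ) (cutTerm-uncrossed g t u p′ x i j ij-uncrossed) ⟩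
      0ℚ + 1ℚ                          ≡⟨ ℚP.+-identityˡ 1ℚ ⟩
      1ℚ                               ≤⟨ 1≤c ⟩
      c                                ≡⟨ update-same x i j c ⟨
      y i j                            ≡⟨ cutTerm-crossed g t u p y i j ij-link crossed ⟨
      cutTerm g t u p y (i , j)        ∎
      where open ℚP.≤-Reasoning

  InPoly-update : InPoly g t y
  InPoly-update = cut-constraint , update-nonneg
    where
    cut-constraint : ∀ u → IsNonLeaf t u → ∀ p → InΠ t u p → ℕtoℚ (numParts u p) - 1ℚ ≤ cutSum g t u p y
    cut-constraint u u-nonleaf p p∈Π = by-crossing (crossesB u p i j) refl
      where
      p′ : Fin n → Fin n
      p′ = mergeParts i j p

      by-crossing : ∀ b → crossesB u p i j ≡ b → ℕtoℚ (numParts u p) - 1ℚ ≤ cutSum g t u p y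
      by-crossing false uncrossed = subst (ℕtoℚ (numParts u p) - 1ℚ ≤_)
        (sym (cutSum-update-uncrossed u p uncrossed)) (proj₁ x∈P u u-nonleaf p p∈Π)
      by-crossing true crossed = begin
        ℕtoℚ (numParts u p) - 1ℚ          ≤⟨ m≤1+n⇒ℕtoℚ[m]-1≤ℕtoℚ[n] (numParts-mergeParts u i j p) ⟩
        ℕtoℚ (numParts u p′)              ≡⟨ p-1+1≡p (ℕtoℚ (numParts u p′)) ⟨
        (ℕtoℚ (numParts u p′) - 1ℚ) + 1ℚ  ≤⟨ ℚP.+-monoˡ-≤ 1ℚ (proj₁ x∈P u u-nonleaf p′ (mergeParts-InΠ i j p∈Π)) ⟩
        cutSum g t u p′ x + 1ℚ            ≤⟨ cutSum-update-crossed u p crossed ⟩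
        cutSum g t u p y                  ∎
        where open ℚP.≤-Reasoning

midpoint-update : ∀ {n} (x : Fin n → Fin n → ℚ) i j c d → x i j ≡ ½ * c + (1ℚ - ½) * d →
  ∀ a b → x a b ≡ ½ * update x i j c a b + (1ℚ - ½) * update x i j d a b
midpoint-update x i j c d midpoint a b with toSum ((a , b) ≟² (i , j))
... | inj₁ refl rewrite update-same x i j c | update-same x i j d = midpoint
... | inj₂ ab≢ij rewrite update-other x i j c ab≢ij | update-other x i j d ab≢ij =
  solve 1 (λ v → v := con ½ :* v :+ (con 1ℚ :- con ½) :* v) refl (x a b)

extreme-link-≯1 : ∀ {n} {g t : Adj n} {x : Fin n → Fin n → ℚ} → IsExtremePoint g t x →
                  ∀ {i j} → IsLink g t i j → ¬ (1ℚ < x i j)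
extreme-link-≯1 {x = x} (x∈P , extreme) {i} {j} ij-link 1<v = ℚP.<-irrefl (sym v≡1) 1<v
  where
  v v′ : ℚ
  v = x i j
  v′ = v + (v - 1ℚ)

  1≤v′ : 1ℚ ≤ v′
  1≤v′ = begin
    1ℚ              ≡⟨ solve 0 (con 1ℚ := con 1ℚ :+ (con 1ℚ :- con 1ℚ)) refl ⟩
    1ℚ + (1ℚ - 1ℚ)  ≤⟨ ℚP.+-mono-≤ (ℚP.<⇒≤ 1<v) (ℚP.+-monoˡ-≤ (ℚ.- 1ℚ) (ℚP.<⇒≤ 1<v)) ⟩
    v′              ∎
    where open ℚP.≤-Reasoning

  v-midpoint : v ≡ ½ * 1ℚ + (1ℚ - ½) * v′
  v-midpoint = solve 1 (λ w → w := con ½ :* con 1ℚ :+ (con 1ℚ :- con ½) :* (w :+ (w :- con 1ℚ))) refl v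

  1≡v′ : 1ℚ ≡ v′
  1≡v′ = begin
    1ℚ                  ≡⟨ update-same x i j 1ℚ ⟨
    update x i j 1ℚ i j ≡⟨ extreme (update x i j 1ℚ) (update x i j v′) ½
                             (InPoly-update x∈P ij-link ℚP.≤-refl) (InPoly-update x∈P ij-link 1≤v′)
                             (toWitness {a? = 0ℚ ℚP.<? ½} _) (toWitness {a? = ½ ℚP.<? 1ℚ} _)
                             (λ a b _ → midpoint-update x i j 1ℚ v′ v-midpoint a b) i j ij-link ⟩
    update x i j v′ i j ≡⟨ update-same x i j v′ ⟩
    v′                  ∎
    where open ≡-Reasoning

  v≡1 : v ≡ 1ℚ
  v≡1 = begin
    v                           ≡⟨ v-midpoint ⟩
    ½ * 1ℚ + (1ℚ - ½) * v′      ≡⟨ cong (λ w → ½ * 1ℚ + (1ℚ - ½) * w) 1≡v′ ⟨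
    ½ * 1ℚ + (1ℚ - ½) * 1ℚ      ≡⟨ solve 0 (con ½ :* con 1ℚ :+ (con 1ℚ :- con ½) :* con 1ℚ := con 1ℚ) refl ⟩
    1ℚ                          ∎
    where open ≡-Reasoning

proposition3p1 : ∀ (n : ℕ) (g t : Adj n) (cost : Fin n → Fin n → ℚ) →
    IsSimpleGraph g → IsSpanningTree g t →
    (∀ (i j : Fin n) → i ─[ g ]─ j → 0ℚ ≤ cost i j) →
    (∀ (i j : Fin n) → i ─[ t ]─ j → cost i j ≡ 0ℚ) →
    ∀ (x : Fin n → Fin n → ℚ) → IsExtremePoint g t x →
    ∀ (i j : Fin n) → IsLink g t i j → (0ℚ ≤ x i j × x i j ≤ 1ℚ)
proposition3p1 n g t cost _ _ _ _ x x-extreme i j ij-link =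
  proj₂ (proj₁ x-extreme) i j ij-link , ℚP.≮⇒≥ (extreme-link-≯1 x-extreme ij-link)
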